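{- Let $\mathsf{L}$ be a normal modal logic admitting finite chains, and let $t(x,y,z) = \Box(y\vee\Box(z\vee x))\vee x$. Then for every $n\in\mathbb{N}$, $\mathcal{V}_{\mathsf{L}}\not\models t^{n}(x,y,z)\approx t^{n+1}(x,y,z)$.
   Context: $\mathcal{V}_{\mathsf{L}}$ is the variety of modal algebras forming the equivalent algebraic semantics of $\mathsf{L}$. Iterates are taken in the first argument: $t^0(x,y,z) := x$ and $t^{k+1}(x,y,z) := t(t^k(x,y,z),y,z)$. A finite chain is a Kripke frame $(C,R)$ with $C$ finite such that the reflexive closure of $R$ is a total order on $C$ (so $R$ is the strict order plus an arbitrary choice of reflexive points). $\mathsf{L}$ admits finite chains if for each $n\in\mathbb{N}$ there is at least one $n$-element finite chain that is a frame for $\mathsf{L}$. -}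

module Defs where

open import Level using (Level; 0ℓ; _⊔_) renaming (suc to lsuc)
open import Data.Nat using (ℕ; zero; suc)
open import Data.Fin using (Fin)
open import Data.Bool using (Bool; true; false; not) renaming (_∧_ to _∧ᵇ_; _∨_ to _∨ᵇ_)
open import Data.Product using (Σ; _×_; _,_)
open import Data.Sum using (_⊎_)
open import Relation.Binary.PropositionalEquality using (_≡_)
open import Algebra.Lattice.Bundles using (BooleanAlgebra)

infixr 5 _⇒_
data Form : Set where
  var : ℕ → Form
  ⊥'  : Form
  _⇒_ : Form → Form → Form
  □'  : Form → Form

¬' : Form → Form
¬' φ = φ ⇒ ⊥'

_∨'_ : Form → Form → Form
φ ∨' ψ = ¬' φ ⇒ ψ

subst : (ℕ → Form) → Form → Form
subst σ (var i) = σ i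
subst σ ⊥' = ⊥'
subst σ (φ ⇒ ψ) = subst σ φ ⇒ subst σ ψ
subst σ (□' φ) = □' (subst σ φ)

-- Normal modal logics: sets of formulas containing the classical
-- propositional axioms (a complete Hilbert basis for →,⊥) and the K axiom,
-- closed under modus ponens, necessitation and uniform substitution.

record IsNormalModalLogic (L : Form → Set) : Set where
  field
    ax1   : ∀ φ ψ → L (φ ⇒ (ψ ⇒ φ))
    ax2   : ∀ φ ψ χ → L ((φ ⇒ (ψ ⇒ χ)) ⇒ ((φ ⇒ ψ) ⇒ (φ ⇒ χ)))
    ax3   : ∀ φ → L (¬' (¬' φ) ⇒ φ)
    axK   : ∀ φ ψ → L (□' (φ ⇒ ψ) ⇒ (□' φ ⇒ □' ψ))
    mp    : ∀ {φ ψ} → L φ → L (φ ⇒ ψ) → L ψ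
    nec   : ∀ {φ} → L φ → L (□' φ)
    sub   : ∀ {φ} (σ : ℕ → Form) → L φ → L (subst σ φ)

record ModalAlgebra (c ℓ : Level) : Set (lsuc (c ⊔ ℓ)) where
  field
    ba : BooleanAlgebra c ℓ
  open BooleanAlgebra ba public
  field
    □      : Carrier → Carrier
    □-cong : ∀ {x y} → x ≈ y → □ x ≈ □ y
    □-⊤    : □ ⊤ ≈ ⊤
    □-∧    : ∀ x y → □ (x ∧ y) ≈ (□ x ∧ □ y)

module _ {c ℓ} (A : ModalAlgebra c ℓ) where
  open ModalAlgebra A

  ⟦_⟧ : Form → (ℕ → Carrier) → Carrier
  ⟦ var i ⟧ v = v i
  ⟦ ⊥' ⟧ v = ⊥
  ⟦ φ ⇒ ψ ⟧ v = (¬ ⟦ φ ⟧ v) ∨ ⟦ ψ ⟧ v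
  ⟦ □' φ ⟧ v = □ (⟦ φ ⟧ v)

  SatisfiesEq : Form → Form → Set (c ⊔ ℓ)
  SatisfiesEq φ ψ = ∀ (v : ℕ → Carrier) → ⟦ φ ⟧ v ≈ ⟦ ψ ⟧ v

  Validates : Form → Set (c ⊔ ℓ)
  Validates φ = ∀ (v : ℕ → Carrier) → ⟦ φ ⟧ v ≈ ⊤

InVariety : ∀ {c ℓ} → (Form → Set) → ModalAlgebra c ℓ → Set (c ⊔ ℓ)
InVariety L A = ∀ φ → L φ → Validates A φ

-- V_L ⊨ φ ≈ ψ  (quantifying over algebras with carrier in Set)
VarietySatisfiesEq : (Form → Set) → Form → Form → Set₁
VarietySatisfiesEq L φ ψ =
  (A : ModalAlgebra 0ℓ 0ℓ) → InVariety L A → SatisfiesEq A φ ψ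

allFin : (n : ℕ) → (Fin n → Bool) → Bool
allFin zero f = true
allFin (suc n) f = f Fin.zero ∧ᵇ allFin n (λ i → f (Fin.suc i))

truth : ∀ {n} → (Fin n → Fin n → Bool) → Form → (ℕ → Fin n → Bool) → Fin n → Bool
truth R (var i) V w = V i w
truth R ⊥' V w = false
truth R (φ ⇒ ψ) V w = not (truth R φ V w) ∨ᵇ truth R ψ V w
truth {n} R (□' φ) V w = allFin n (λ u → not (R w u) ∨ᵇ truth R φ V u)

FrameValidates : ∀ {n} → (Fin n → Fin n → Bool) → Form → Set
FrameValidates {n} R φ = ∀ (V : ℕ → Fin n → Bool) (w : Fin n) → truth R φ V w ≡ true

ReflClo : ∀ {n} → (Fin n → Fin n → Bool) → Fin n → Fin n → Set
ReflClo R i j = (i ≡ j) ⊎ (R i j ≡ true)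

IsFiniteChain : ∀ {n} → (Fin n → Fin n → Bool) → Set
IsFiniteChain R =
    (∀ i j → ReflClo R i j → ReflClo R j i → i ≡ j)
  × (∀ i j k → ReflClo R i j → ReflClo R j k → ReflClo R i k)
  × (∀ i j → ReflClo R i j ⊎ ReflClo R j i)

IsFrameFor : ∀ {n} → (Form → Set) → (Fin n → Fin n → Bool) → Set
IsFrameFor L R = ∀ φ → L φ → FrameValidates R φ

AdmitsFiniteChains : (Form → Set) → Set
AdmitsFiniteChains L =
  ∀ (n : ℕ) → Σ (Fin n → Fin n → Bool) (λ R → IsFiniteChain R × IsFrameFor L R)

t : Form → Form → Form → Form
t x y z = □' (y ∨' □' (z ∨' x)) ∨' x

tIter : ℕ → Form → Form → Form → Form
tIter zero x y z = x
tIter (suc k) x y z = t (tIter k x y z) y z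

x₀ y₀ z₀ : Form
x₀ = var 0
y₀ = var 1
z₀ = var 2

-- Interpret x as the empty set, z as a set Z of worlds and y as its complement.
-- Then t(φ) fails at w exactly when φ fails at w and w sees a Z-world that sees
-- a world outside Z where φ fails; so tⁿ fails at w iff a zigzag of n such double
-- steps starts at w. Label a chain of 2n+1 worlds alternately, its least world
-- outside Z: the least world starts a zigzag of length n but none of length n+1,
-- which would need 2n+3 distinct worlds. Hence tⁿ and tⁿ⁺¹ differ in the complex
-- algebra of the chain, which lies in V_L.
module Submission where

open import Defs hiding (subst)
open import Level using (0ℓ)
open import Data.Nat using (ℕ; zero; suc; _*_; _<_; _≤_; s≤s⁻¹; ⌊_/2⌋)
open import Data.Nat.Properties using (suc-injective; *-suc; *-monoʳ-<; <⇒≱; n<1+n)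
open import Data.Fin using (Fin; zero; suc; _≟_)
open import Data.Fin.Properties using (injective⇒≤)
open import Data.Bool using (Bool; true; false; not) renaming (_∧_ to _∧ᵇ_; _∨_ to _∨ᵇ_)
open import Data.Bool.Properties as Bool
  using (∨-∧-booleanAlgebra; ∨-zeroʳ; ∧-zeroʳ; ∨-identityʳ; ∨-distribˡ-∧;
         not-involutive; not-injective)
open import Data.Vec using (Vec; lookup; tabulate; map; replicate; _⊛_)
open import Data.Vec.Properties using (lookup∘tabulate; lookup-map; lookup-replicate; lookup-⊛)
open import Data.Vec.Relation.Binary.Pointwise.Extensional using (ext; Pointwise)
open import Algebra.Lattice.Properties.BooleanAlgebra.Expression ∨-∧-booleanAlgebra using (lift)
open import Data.List using (List; []; _∷_; length)
import Data.List as List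
open import Data.List.Properties using (length-tabulate)
open import Data.List.Membership.Propositional.Properties using (∈-lookup)
open import Data.List.Relation.Unary.All as All using (All; []; _∷_)
open import Data.List.Relation.Unary.AllPairs as AllPairs using ([]; _∷_)
open import Data.List.Relation.Unary.Unique.Propositional using (Unique)
open import Data.List.Relation.Unary.Unique.Propositional.Properties using (allFin⁺)
open import Data.List.Relation.Unary.Linked as Linked using (Linked; [-]; _∷_)
open import Data.List.Relation.Unary.Linked.Properties using (AllPairs⇒Linked; Linked⇒AllPairs)
open import Data.List.Relation.Binary.Permutation.Propositional using (↭-sym; ↭⇒↭ₛ)
open import Data.List.Relation.Binary.Permutation.Propositional.Properties using (↭-length)
open import Data.List.Relation.Binary.Permutation.Setoid.Properties using (Unique-resp-↭)
open import Data.Product using (Σ-syntax; _×_; _,_; proj₁; proj₂)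
open import Data.Sum using (inj₁; inj₂)
open import Data.Unit using (⊤; tt)
open import Function.Definitions using (Injective)
open import Relation.Binary using (Rel; DecidableEquality; DecTotalOrder)
open import Relation.Binary.Construct.Intersection using (_∩_)
open import Relation.Binary.PropositionalEquality
  using (_≡_; _≢_; ≢-sym; refl; sym; trans; cong; cong₂; subst; setoid; isEquivalence;
         module ≡-Reasoning)
open import Relation.Nullary using (¬_; Dec; yes; no; contradiction)

open ≡-Reasoning

allFin-cong : ∀ n {f g : Fin n → Bool} → (∀ i → f i ≡ g i) → allFin n f ≡ allFin n g
allFin-cong zero    f≗g = refl
allFin-cong (suc n) f≗g = cong₂ _∧ᵇ_ (f≗g zero) (allFin-cong n (λ i → f≗g (suc i)))

allFin-true : ∀ n {f : Fin n → Bool} → (∀ i → f i ≡ true) → allFin n f ≡ true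
allFin-true zero    f≡true = refl
allFin-true (suc n) f≡true rewrite f≡true zero = allFin-true n (λ i → f≡true (suc i))

allFin-false : ∀ n {f : Fin n → Bool} i → f i ≡ false → allFin n f ≡ false
allFin-false (suc n)     zero    fi≡false rewrite fi≡false = refl
allFin-false (suc n) {f} (suc i) fi≡false with f zero
... | false = refl
... | true  = allFin-false n i fi≡false

allFin-∧ : ∀ n (f g : Fin n → Bool) → allFin n (λ i → f i ∧ᵇ g i) ≡ allFin n f ∧ᵇ allFin n g
allFin-∧ zero    f g = refl
allFin-∧ (suc n) f g with f zero | g zero
... | false | _     = refl
... | true  | false = sym (∧-zeroʳ _)
... | true  | true  = allFin-∧ n _ _

∨-true : ∀ a {b} → (a ≡ false → b ≡ true) → a ∨ᵇ b ≡ true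
∨-true true  _ = refl
∨-true false b≡true = b≡true refl

module KripkeSemantics {m} (R : Fin m → Fin m → Bool) where

  truth-cong : ∀ φ {V V′ : ℕ → Fin m → Bool} → (∀ i w → V i w ≡ V′ i w) →
               ∀ w → truth R φ V w ≡ truth R φ V′ w
  truth-cong (var i) V≗V′ w = V≗V′ i w
  truth-cong ⊥'      V≗V′ w = refl
  truth-cong (φ ⇒ ψ) V≗V′ w =
    cong₂ (λ a b → not a ∨ᵇ b) (truth-cong φ V≗V′ w) (truth-cong ψ V≗V′ w)
  truth-cong (□' φ)  V≗V′ w =
    allFin-cong m (λ u → cong (not (R w u) ∨ᵇ_) (truth-cong φ V≗V′ u))

  truth-∨' : ∀ φ ψ V w → truth R (φ ∨' ψ) V w ≡ truth R φ V w ∨ᵇ truth R ψ V w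
  truth-∨' φ ψ V w =
    cong (_∨ᵇ truth R ψ V w) (trans (cong not (∨-identityʳ _)) (not-involutive _))

  truth-□'-false : ∀ φ {V w} u → R w u ≡ true → truth R φ V u ≡ false →
                   truth R (□' φ) V w ≡ false
  truth-□'-false φ u wRu φ≡false = allFin-false m u (cong₂ (λ a b → not a ∨ᵇ b) wRu φ≡false)

  truth-□'-true : ∀ φ {V w} → (∀ u → R w u ≡ true → truth R φ V u ≡ true) →
                  truth R (□' φ) V w ≡ true
  truth-□'-true φ {w = w} φ≡true =
    allFin-true m (λ u → ∨-true (not (R w u)) (λ ¬wRu → φ≡true u (not-injective ¬wRu)))

lookup-map-⊛ : ∀ {n} (f : Bool → Bool → Bool) (X Y : Vec Bool n) w →
               lookup (map f X ⊛ Y) w ≡ f (lookup X w) (lookup Y w)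
lookup-map-⊛ f X Y w =
  trans (lookup-⊛ w (map f X) Y) (cong (λ g → g (lookup Y w)) (lookup-map w f X))

module ComplexAlgebra {m} (R : Fin m → Fin m → Bool) where

  open KripkeSemantics R

  -- Subsets of the frame are characteristic vectors, so that `lift` supplies the Boolean structure.
  box : Vec Bool m → Vec Bool m
  box X = tabulate λ w → allFin m λ u → not (R w u) ∨ᵇ lookup X u

  lookup-box : ∀ X w → lookup (box X) w ≡ allFin m (λ u → not (R w u) ∨ᵇ lookup X u)
  lookup-box X = lookup∘tabulate _

  box-cong : ∀ {X Y} → (∀ u → lookup X u ≡ lookup Y u) →
             ∀ w → lookup (box X) w ≡ lookup (box Y) w
  box-cong {X} {Y} X≗Y w = begin
    lookup (box X) w                            ≡⟨ lookup-box X w ⟩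
    allFin m (λ u → not (R w u) ∨ᵇ lookup X u)
      ≡⟨ allFin-cong m (λ u → cong (not (R w u) ∨ᵇ_) (X≗Y u)) ⟩
    allFin m (λ u → not (R w u) ∨ᵇ lookup Y u)  ≡⟨ lookup-box Y w ⟨
    lookup (box Y) w                            ∎

  box-true : ∀ w → lookup (box (replicate m true)) w ≡ true
  box-true w = trans (lookup-box (replicate m true) w) (allFin-true m λ u →
    trans (cong (not (R w u) ∨ᵇ_) (lookup-replicate u true)) (∨-zeroʳ _))

  box-∧ : ∀ X Y w → lookup (box (map _∧ᵇ_ X ⊛ Y)) w ≡ lookup (box X) w ∧ᵇ lookup (box Y) w
  box-∧ X Y w = begin
    lookup (box (map _∧ᵇ_ X ⊛ Y)) w
      ≡⟨ lookup-box (map _∧ᵇ_ X ⊛ Y) w ⟩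
    allFin m (λ u → not (R w u) ∨ᵇ lookup (map _∧ᵇ_ X ⊛ Y) u)
      ≡⟨ allFin-cong m (λ u → trans (cong (not (R w u) ∨ᵇ_) (lookup-map-⊛ _∧ᵇ_ X Y u))
                                     (∨-distribˡ-∧ (not (R w u)) _ _)) ⟩
    allFin m (λ u → (not (R w u) ∨ᵇ lookup X u) ∧ᵇ (not (R w u) ∨ᵇ lookup Y u))
      ≡⟨ allFin-∧ m _ _ ⟩
    allFin m (λ u → not (R w u) ∨ᵇ lookup X u) ∧ᵇ allFin m (λ u → not (R w u) ∨ᵇ lookup Y u)
      ≡⟨ cong₂ _∧ᵇ_ (lookup-box X w) (lookup-box Y w) ⟨
    lookup (box X) w ∧ᵇ lookup (box Y) w        ∎

  complexAlgebra : ModalAlgebra 0ℓ 0ℓ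
  complexAlgebra = record
    { ba     = lift m
    ; □      = box
    ; □-cong = λ {X} {Y} X≈Y → ext (box-cong {X} {Y} (Pointwise.app X≈Y))
    ; □-⊤    = ext λ w → trans (box-true w) (sym (lookup-replicate w true))
    ; □-∧    = λ X Y → ext λ w → trans (box-∧ X Y w) (sym (lookup-map-⊛ _∧ᵇ_ (box X) (box Y) w))
    }

  lookup-⟦⟧ : ∀ φ v w → lookup (⟦ complexAlgebra ⟧ φ v) w ≡ truth R φ (λ i → lookup (v i)) w
  lookup-⟦⟧ (var i) v w = refl
  lookup-⟦⟧ ⊥'      v w = lookup-replicate w false
  lookup-⟦⟧ (φ ⇒ ψ) v w =
    trans (lookup-map-⊛ _∨ᵇ_ (map not ⟦φ⟧) ⟦ψ⟧ w)
          (cong₂ _∨ᵇ_ (trans (lookup-map w not ⟦φ⟧) (cong not (lookup-⟦⟧ φ v w)))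
                      (lookup-⟦⟧ ψ v w))
    where
    ⟦φ⟧ ⟦ψ⟧ : Vec Bool m
    ⟦φ⟧ = ⟦ complexAlgebra ⟧ φ v
    ⟦ψ⟧ = ⟦ complexAlgebra ⟧ ψ v
  lookup-⟦⟧ (□' φ)  v w =
    trans (lookup-box (⟦ complexAlgebra ⟧ φ v) w)
          (allFin-cong m (λ u → cong (not (R w u) ∨ᵇ_) (lookup-⟦⟧ φ v u)))

  complexAlgebra-inVariety : ∀ {L} → IsFrameFor L R → InVariety L complexAlgebra
  complexAlgebra-inVariety frame φ φ∈L v = ext λ w →
    trans (lookup-⟦⟧ φ v w) (trans (frame φ φ∈L _ w) (sym (lookup-replicate w true)))

  complexAlgebra-⊨⇒truth-≡ : ∀ φ ψ → SatisfiesEq complexAlgebra φ ψ →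
                             ∀ V w → truth R φ V w ≡ truth R ψ V w
  complexAlgebra-⊨⇒truth-≡ φ ψ φ≈ψ V w = begin
    truth R φ V w                              ≡⟨ truth-cong φ V≗lookup w ⟩
    truth R φ (λ i → lookup (tabulate (V i))) w ≡⟨ lookup-⟦⟧ φ (V̂) w ⟨
    lookup (⟦ complexAlgebra ⟧ φ (V̂)) w ≡⟨ Pointwise.app (φ≈ψ (V̂)) w ⟩
    lookup (⟦ complexAlgebra ⟧ ψ (V̂)) w ≡⟨ lookup-⟦⟧ ψ (V̂) w ⟩
    truth R ψ (λ i → lookup (tabulate (V i))) w ≡⟨ truth-cong ψ V≗lookup w ⟨
    truth R ψ V w                              ∎
    where
    V̂ : ℕ → Vec Bool m
    V̂ i = tabulate (V i)
    V≗lookup : ∀ i u → V i u ≡ lookup (tabulate (V i)) u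
    V≗lookup i u = sym (lookup∘tabulate (V i) u)

module _ {A : Set} where

  lookup-injective : ∀ {xs : List A} → Unique xs → Injective _≡_ _≡_ (List.lookup xs)
  lookup-injective (_ ∷ _)    {zero}  {zero}  _  = refl
  lookup-injective (x∉xs ∷ _) {zero}  {suc j} eq = contradiction eq (All.lookup x∉xs (∈-lookup j))
  lookup-injective (x∉xs ∷ _) {suc i} {zero}  eq = contradiction (sym eq) (All.lookup x∉xs (∈-lookup i))
  lookup-injective (_ ∷ uniq) {suc i} {suc j} eq = cong suc (lookup-injective uniq eq)

  Alternating : (A → Bool) → Bool → List A → Set
  Alternating z b []       = ⊤
  Alternating z b (x ∷ xs) = z x ≡ b × Alternating z (not b) xs

  Alternating-cong : ∀ {z z′ b} xs → All (λ x → z x ≡ z′ x) xs →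
                     Alternating z b xs → Alternating z′ b xs
  Alternating-cong []       []             _           = tt
  Alternating-cong (x ∷ xs) (zx≡z′x ∷ eqs) (zx≡b , alt) =
    trans (sym zx≡z′x) zx≡b , Alternating-cong xs eqs alt

  module _ (_≟A_ : DecidableEquality A) where

    alternate : Bool → List A → A → Bool
    alternate b []       y = b
    alternate b (x ∷ xs) y with y ≟A x
    ... | yes _ = b
    ... | no  _ = alternate (not b) xs y

    alternate-head : ∀ b x xs → alternate b (x ∷ xs) x ≡ b
    alternate-head b x xs with x ≟A x
    ... | yes _   = refl
    ... | no  x≢x = contradiction refl x≢x

    alternate-tail : ∀ b x xs {y} → x ≢ y → alternate b (x ∷ xs) y ≡ alternate (not b) xs y
    alternate-tail b x xs {y} x≢y with y ≟A x
    ... | yes y≡x = contradiction (sym y≡x) x≢y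
    ... | no  _   = refl

    alternate-alternating : ∀ b {xs} → Unique xs → Alternating (alternate b xs) b xs
    alternate-alternating b {[]}     []             = tt
    alternate-alternating b {x ∷ xs} (x∉xs ∷ uniq) =
      alternate-head b x xs ,
      Alternating-cong xs (All.map (λ x≢y → sym (alternate-tail b x xs x≢y)) x∉xs)
                          (alternate-alternating (not b) uniq)

Unique-length≤ : ∀ {m} {xs : List (Fin m)} → Unique xs → length xs ≤ m
Unique-length≤ uniq = injective⇒≤ (lookup-injective uniq)

⌊2*n/2⌋≡n : ∀ n → ⌊ 2 * n /2⌋ ≡ n
⌊2*n/2⌋≡n zero    = refl
⌊2*n/2⌋≡n (suc n) = trans (cong ⌊_/2⌋ (*-suc 2 n)) (cong suc (⌊2*n/2⌋≡n n))

module Zigzags {m} (R : Fin m → Fin m → Bool) (z : Fin m → Bool) where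

  open KripkeSemantics R

  Step : Fin m → Fin m → Set
  Step w v = Σ[ u ∈ Fin m ] R w u ≡ true × z u ≡ true × R u v ≡ true × z v ≡ false

  Zigzag : ℕ → Fin m → Set
  Zigzag zero    w = ⊤
  Zigzag (suc k) w = Σ[ v ∈ Fin m ] Step w v × Zigzag k v

  zigzag-shorten : ∀ k {w} → Zigzag (suc k) w → Zigzag k w
  zigzag-shorten zero    _                  = tt
  zigzag-shorten (suc k) (v , step , zigzag) = v , step , zigzag-shorten k zigzag

  valuation : ℕ → Fin m → Bool
  valuation 0             _ = false
  valuation 1             w = not (z w)
  valuation (suc (suc _)) w = z w

  infix 5 _⊩_
  _⊩_ : Fin m → Form → Bool
  w ⊩ φ = truth R φ valuation w

  private
    ∨'-false : ∀ φ ψ {w} → w ⊩ φ ≡ false → w ⊩ ψ ≡ false → w ⊩ φ ∨' ψ ≡ false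
    ∨'-false φ ψ {w} φ≡false ψ≡false = trans (truth-∨' φ ψ valuation w) (cong₂ _∨ᵇ_ φ≡false ψ≡false)

    ∨'-trueˡ : ∀ φ ψ {w} → w ⊩ φ ≡ true → w ⊩ φ ∨' ψ ≡ true
    ∨'-trueˡ φ ψ {w} φ≡true = trans (truth-∨' φ ψ valuation w) (cong (_∨ᵇ (w ⊩ ψ)) φ≡true)

    ∨'-true : ∀ φ ψ {w} → (w ⊩ φ ≡ false → w ⊩ ψ ≡ true) → w ⊩ φ ∨' ψ ≡ true
    ∨'-true φ ψ {w} ψ≡true = trans (truth-∨' φ ψ valuation w) (∨-true (w ⊩ φ) ψ≡true)

  truth-t-false : ∀ φ {w v} → w ⊩ φ ≡ false → Step w v → v ⊩ φ ≡ false → w ⊩ t φ y₀ z₀ ≡ false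
  truth-t-false φ {v = v} φw≡false (u , wRu , zu , uRv , zv) φv≡false =
    ∨'-false (□' χ) φ
      (truth-□'-false χ u wRu (∨'-false y₀ (□' ψ) (cong not zu)
        (truth-□'-false ψ v uRv (∨'-false z₀ φ zv φv≡false))))
      φw≡false
    where
    ψ χ : Form
    ψ = z₀ ∨' φ
    χ = y₀ ∨' □' ψ

  truth-t-true : ∀ φ {w} → (∀ v → Step w v → v ⊩ φ ≡ true) → w ⊩ t φ y₀ z₀ ≡ true
  truth-t-true φ φ≡true =
    ∨'-trueˡ (□' χ) φ (truth-□'-true χ λ u wRu → ∨'-true y₀ (□' ψ) λ ¬zu →
      truth-□'-true ψ λ v uRv → ∨'-true z₀ φ λ zv →
        φ≡true v (u , wRu , not-injective ¬zu , uRv , zv))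
    where
    ψ χ : Form
    ψ = z₀ ∨' φ
    χ = y₀ ∨' □' ψ

  truth-tIter-false : ∀ k {w} → Zigzag k w → w ⊩ tIter k x₀ y₀ z₀ ≡ false
  truth-tIter-false zero    _                           = refl
  truth-tIter-false (suc k) zigzag@(v , step , zigzag′) =
    truth-t-false (tIter k x₀ y₀ z₀)
      (truth-tIter-false k (zigzag-shorten k zigzag)) step (truth-tIter-false k zigzag′)

  truth-tIter-true : ∀ k {w} → ¬ Zigzag k w → w ⊩ tIter k x₀ y₀ z₀ ≡ true
  truth-tIter-true zero    ¬zigzag = contradiction tt ¬zigzag
  truth-tIter-true (suc k) ¬zigzag =
    truth-t-true (tIter k x₀ y₀ z₀) λ v step →
      truth-tIter-true k (λ zigzag → ¬zigzag (v , step , zigzag))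

labels-differ : ∀ {A : Set} (z : A → Bool) {a b} → z a ≡ false → z b ≡ true → a ≢ b
labels-differ z za≡false zb≡true refl = contradiction (trans (sym za≡false) zb≡true) λ ()

module FiniteChain {m} {R : Fin m → Fin m → Bool} (chain : IsFiniteChain R) where

  _≼_ : Rel (Fin m) 0ℓ
  _≼_ = ReflClo R

  _≺_ : Rel (Fin m) 0ℓ
  _≺_ = _≼_ ∩ _≢_

  private
    ≼-antisym : ∀ {i j} → i ≼ j → j ≼ i → i ≡ j
    ≼-antisym = proj₁ chain _ _

    ≼-trans : ∀ {i j k} → i ≼ j → j ≼ k → i ≼ k
    ≼-trans = proj₁ (proj₂ chain) _ _ _

  ≺-trans : ∀ {i j k} → i ≺ j → j ≺ k → i ≺ k
  ≺-trans (i≼j , i≢j) (j≼k , _) = ≼-trans i≼j j≼k , λ { refl → i≢j (≼-antisym i≼j j≼k) }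

  ≺⇒R : ∀ {i j} → i ≺ j → R i j ≡ true
  ≺⇒R (inj₁ i≡j , i≢j) = contradiction i≡j i≢j
  ≺⇒R (inj₂ iRj , _)   = iRj

  _≼?_ : ∀ i j → Dec (i ≼ j)
  i ≼? j with i ≟ j | R i j Bool.≟ true
  ... | yes i≡j | _        = yes (inj₁ i≡j)
  ... | no  _   | yes iRj  = yes (inj₂ iRj)
  ... | no  i≢j | no  ¬iRj = no λ { (inj₁ i≡j) → i≢j i≡j ; (inj₂ iRj) → ¬iRj iRj }

  decTotalOrder : DecTotalOrder 0ℓ 0ℓ 0ℓ
  decTotalOrder = record
    { Carrier         = Fin m
    ; _≈_             = _≡_
    ; _≤_             = _≼_
    ; isDecTotalOrder = record
      { isTotalOrder = record
        { isPartialOrder = record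
          { isPreorder = record { isEquivalence = isEquivalence ; reflexive = inj₁ ; trans = ≼-trans }
          ; antisym    = ≼-antisym
          }
        ; total = proj₂ (proj₂ chain)
        }
      ; _≟_  = _≟_
      ; _≤?_ = _≼?_
      }
    }

  ascending⇒unique : ∀ {xs} → Linked _≺_ xs → Unique xs
  ascending⇒unique asc = AllPairs.map proj₂ (Linked⇒AllPairs ≺-trans asc)

  ascending-enumeration : Σ[ xs ∈ List (Fin m) ] Linked _≺_ xs × length xs ≡ m
  ascending-enumeration =
    sorted , Linked.zip (sort-↗ (List.allFin m) , AllPairs⇒Linked sorted-unique) , sorted-length
    where
    open import Data.List.Sort decTotalOrder using (sort; sort-↭; sort-↗)
    sorted : List (Fin m)
    sorted = sort (List.allFin m)
    sorted-unique : Unique sorted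
    sorted-unique =
      Unique-resp-↭ (setoid (Fin m)) (↭⇒↭ₛ (↭-sym (sort-↭ (List.allFin m)))) (allFin⁺ m)
    sorted-length : length sorted ≡ m
    sorted-length = trans (↭-length (sort-↭ (List.allFin m))) (length-tabulate (λ i → i))

  module _ (z : Fin m → Bool) where

    open Zigzags R z using (Zigzag)

    zigzag⇒ascending : ∀ k {w} → z w ≡ false → Zigzag k w →
                       Σ[ xs ∈ List (Fin m) ] Linked _≺_ (w ∷ xs) × length xs ≡ 2 * k
    zigzag⇒ascending zero    _        _                                          = [] , [-] , refl
    zigzag⇒ascending (suc k) zw≡false (v , (u , wRu , zu≡true , uRv , zv≡false) , zigzag) =
      let xs , asc , len = zigzag⇒ascending k zv≡false zigzag in
      u ∷ v ∷ xs ,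
      (inj₂ wRu , labels-differ z zw≡false zu≡true) ∷
        (inj₂ uRv , ≢-sym (labels-differ z zv≡false zu≡true)) ∷ asc ,
      trans (cong (λ l → suc (suc l)) len) (sym (*-suc 2 k))

    zigzag-bound : ∀ k {w} → z w ≡ false → Zigzag k w → 2 * k < m
    zigzag-bound k zw≡false zigzag =
      let xs , asc , len = zigzag⇒ascending k zw≡false zigzag in
      subst (λ l → suc l ≤ m) len (Unique-length≤ (ascending⇒unique asc))

    alternating⇒zigzag : ∀ {a xs} → Linked _≺_ (a ∷ xs) → Alternating z false (a ∷ xs) →
                         Zigzag ⌊ length xs /2⌋ a
    alternating⇒zigzag [-]       _ = tt
    alternating⇒zigzag (_ ∷ [-]) _ = tt
    alternating⇒zigzag {xs = b ∷ c ∷ _} (a≺b ∷ b≺c ∷ asc) (_ , zb≡true , zc≡false , alt) =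
      c , (b , ≺⇒R a≺b , zb≡true , ≺⇒R b≺c , zc≡false) , alternating⇒zigzag asc (zc≡false , alt)

zigzag-separation : ∀ n {R : Fin (suc (2 * n)) → Fin (suc (2 * n)) → Bool} → IsFiniteChain R →
  Σ[ z ∈ (Fin (suc (2 * n)) → Bool) ] Σ[ a ∈ Fin (suc (2 * n)) ]
    Zigzags.Zigzag R z n a × ¬ Zigzags.Zigzag R z (suc n) a
zigzag-separation n {R} chain with FiniteChain.ascending-enumeration chain
... | a ∷ xs , asc , len = z , a , zigzag , ¬zigzag
  where
  open FiniteChain chain
  open Zigzags R using (Zigzag)
  z : Fin (suc (2 * n)) → Bool
  z = alternate _≟_ false (a ∷ xs)
  alt : Alternating z false (a ∷ xs)
  alt = alternate-alternating _≟_ false (ascending⇒unique asc)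
  zigzag : Zigzag z n a
  zigzag = subst (λ k → Zigzag z k a) (trans (cong ⌊_/2⌋ (suc-injective len)) (⌊2*n/2⌋≡n n))
                 (alternating⇒zigzag z asc alt)
  ¬zigzag : ¬ Zigzag z (suc n) a
  ¬zigzag zigzag′ =
    <⇒≱ (*-monoʳ-< 2 (n<1+n n)) (s≤s⁻¹ (zigzag-bound z (suc n) (proj₁ alt) zigzag′))

lemma4p2 : (L : Form → Set) → IsNormalModalLogic L → AdmitsFiniteChains L →
    (n : ℕ) → ¬ VarietySatisfiesEq L (tIter n x₀ y₀ z₀) (tIter (suc n) x₀ y₀ z₀)
lemma4p2 L _ admitsChains n tⁿ≈tⁿ⁺¹ with admitsChains (suc (2 * n))
... | R , chain , frame with zigzag-separation n chain
...   | z , a , zigzag , ¬zigzag = contradiction false≡true λ ()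
  where
  open ComplexAlgebra R
  open Zigzags R z using (valuation; _⊩_; truth-tIter-false; truth-tIter-true)
  tⁿ≡tⁿ⁺¹ : ∀ V w → truth R (tIter n x₀ y₀ z₀) V w ≡ truth R (tIter (suc n) x₀ y₀ z₀) V w
  tⁿ≡tⁿ⁺¹ = complexAlgebra-⊨⇒truth-≡ (tIter n x₀ y₀ z₀) (tIter (suc n) x₀ y₀ z₀)
              (tⁿ≈tⁿ⁺¹ complexAlgebra (complexAlgebra-inVariety frame))
  false≡true : false ≡ true
  false≡true = begin
    false                         ≡⟨ truth-tIter-false n zigzag ⟨
    a ⊩ tIter n x₀ y₀ z₀          ≡⟨ tⁿ≡tⁿ⁺¹ valuation a ⟩
    a ⊩ tIter (suc n) x₀ y₀ z₀    ≡⟨ truth-tIter-true (suc n) ¬zigzag ⟩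
    true                          ∎
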